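{- Let $d$ be either $0$ or a positive square-free integer, $K=\mathbb{Q}(\sqrt{ -d})$, $R$ the ring of integers of $K$. For each integer $n\geq1$, the graphs $\Gamma_{1,n}$ and $\Gamma^{un}_{2,n}$ are cographs, i.e. neither contains the path graph $P_4$ on four vertices as an induced subgraph.
   Context: The zero-divisor graph $\Gamma(M_2(R))$ is the directed graph whose vertices are the nonzero (left or right) zero-divisors of $M_2(R)$, with an edge $v_1\to v_2$ between distinct vertices iff $v_1v_2=0$. For an integer $N\geq1$ and $t\in R$, let $S_{tc,1,t,N}=\{\lambda\begin{bmatrix}1&t\\t^2&t^3\end{bmatrix}:\lambda\in\mathbb{Z},\,1\leq|\lambda|\leq N\}$ and $S_{tc,2,N}=\{\begin{bmatrix}0&0\\0&\lambda\end{bmatrix}:\lambda\in\mathbb{Z},\,1\leq|\lambda|\leq N\}$. Let $\Gamma_{1,N}$ be the induced subgraph of $\Gamma(M_2(R))$ on $S_{tc,1,0,N}\cup S_{tc,2,N}$, regarded as an undirected graph. Let $U=\{\pm1\}$ if $d\neq1,3$, $U=\{\pm1,\pm i\}$ if $d=1$ ($i=\sqrt{ -1}$), $U=\{\pm1,\pm\omega,\pm\omega^2\}$ if $d=3$ ($\omega$ a primitive third root of unity); let $\Gamma_{2,N}$ be the induced subgraph of $\Gamma(M_2(R))$ on $\bigcup_{j\in U}S_{tc,1,j,N}$, and $\Gamma^{un}_{2,N}$ its underlying undirected graph (distinct $v_1,v_2$ adjacent iff $v_1v_2=0$ or $v_2v_1=0$). -}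

module Defs where

open import Data.Bool using (Bool; true; false; if_then_else_)
open import Data.Nat as ℕ using (ℕ; zero; suc; _≡ᵇ_)
open import Data.Nat.DivMod using (_%_; _/_)
open import Data.Nat.Divisibility using (_∣_)
open import Data.Integer as ℤ using (ℤ; +_; ∣_∣)
open import Data.Product using (Σ; ∃; _×_; _,_)
open import Data.Sum using (_⊎_)
open import Relation.Binary.PropositionalEquality using (_≡_; _≢_)
open import Relation.Nullary using (¬_)

SquareFree : ℕ → Set
SquareFree d = ∀ k → (k ℕ.* k) ∣ d → k ≡ 1

Admissible : ℕ → Set
Admissible d = d ≡ 0 ⊎ (0 ℕ.< d × SquareFree d)

-- The ring of integers R of K = ℚ(√-d).
--  * d = 0 : K = ℚ, R = ℤ.
--  * d ≥ 1 : R = ℤ[θ] with ℤ-basis {1, θ}, where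
--      θ = √-d           if d ≢ 3 (mod 4),   θ² = -d,
--      θ = (1 + √-d)/2   if d ≡ 3 (mod 4),   θ² = θ - (d+1)/4.
--    An element a + bθ is represented by the pair (a , b) (unique
--    representation, so propositional equality is equality in R).

R : ℕ → Set
R zero    = ℤ
R (suc _) = ℤ × ℤ

three-mod-four : ℕ → Bool
three-mod-four d = (d % 4) ≡ᵇ 3

-- θ² = θs · θ + θr
θs : ℕ → ℤ
θs d = if three-mod-four d then + 1 else + 0

θr : ℕ → ℤ
θr d = if three-mod-four d then ℤ.- (+ ((d ℕ.+ 1) / 4)) else ℤ.- (+ d)

0R : ∀ d → R d
0R zero    = + 0
0R (suc _) = (+ 0 , + 0)

1R : ∀ d → R d
1R zero    = + 1
1R (suc _) = (+ 1 , + 0)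

ι : ∀ d → ℤ → R d
ι zero    n = n
ι (suc _) n = (n , + 0)

infixl 6 _+R_
infixl 7 _*R_

_+R_ : ∀ {d} → R d → R d → R d
_+R_ {zero}  x y = x ℤ.+ y
_+R_ {suc _} (a , b) (c , e) = (a ℤ.+ c , b ℤ.+ e)

-R_ : ∀ {d} → R d → R d
-R_ {zero}  x = ℤ.- x
-R_ {suc _} (a , b) = (ℤ.- a , ℤ.- b)

-- (a + bθ)(c + eθ) = ac + (ae + bc)θ + be θ²,  θ² = θs θ + θr
_*R_ : ∀ {d} → R d → R d → R d
_*R_ {zero}  x y = x ℤ.* y
_*R_ {suc k} (a , b) (c , e) =
  ( a ℤ.* c ℤ.+ b ℤ.* e ℤ.* θr (suc k)
  , a ℤ.* e ℤ.+ b ℤ.* c ℤ.+ b ℤ.* e ℤ.* θs (suc k) )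

-- The generator θ (for d ≥ 1).  For d = 1, θ = i = √-1.
θ : ∀ k → R (suc k)
θ _ = (+ 0 , + 1)

-- For d = 3, a primitive third root of unity ω = θ - 1 = (-1 + √-3)/2.
ω₃ : ∀ k → R (suc k)
ω₃ _ = (ℤ.- (+ 1) , + 1)

U : ∀ d → R d → Set
U zero    t = t ≡ 1R 0 ⊎ t ≡ -R_ {0} (1R 0)
U (suc k) t =
  t ≡ 1R d ⊎ t ≡ neg (1R d)
  ⊎ (d ≡ 1 × (t ≡ θ k ⊎ t ≡ neg (θ k)))
  ⊎ (d ≡ 3 × (t ≡ ω₃ k ⊎ t ≡ neg (ω₃ k)
             ⊎ t ≡ ω₃ k ⋆ ω₃ k ⊎ t ≡ neg (ω₃ k ⋆ ω₃ k)))
  where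
    d = suc k
    neg : R d → R d
    neg = -R_ {d}
    _⋆_ : R d → R d → R d
    _⋆_ = _*R_ {d}

record M₂ (d : ℕ) : Set where
  constructor mat
  field
    m11 m12 m21 m22 : R d
open M₂ public

0M : ∀ d → M₂ d
0M d = mat (0R d) (0R d) (0R d) (0R d)

infixl 7 _·M_

_·M_ : ∀ {d} → M₂ d → M₂ d → M₂ d
mat a b c e ·M mat a' b' c' e' =
  mat (a *R a' +R b *R c') (a *R b' +R b *R e')
      (c *R a' +R e *R c') (c *R b' +R e *R e')

_•_ : ∀ {d} → R d → M₂ d → M₂ d
s • mat a b c e = mat (s *R a) (s *R b) (s *R c) (s *R e)

IsVertex : ∀ {d} → M₂ d → Set
IsVertex {d} A =
  A ≢ 0M d × ∃ λ B → B ≢ 0M d × (A ·M B ≡ 0M d ⊎ B ·M A ≡ 0M d)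

Edge : ∀ {d} → M₂ d → M₂ d → Set
Edge {d} v₁ v₂ = v₁ ≢ v₂ × v₁ ·M v₂ ≡ 0M d

UAdj : ∀ {d} → M₂ d → M₂ d → Set
UAdj v₁ v₂ = Edge v₁ v₂ ⊎ Edge v₂ v₁

InRange : ℕ → ℤ → Set
InRange N λ′ = 1 ℕ.≤ ∣ λ′ ∣ × ∣ λ′ ∣ ℕ.≤ N

S₁ : ∀ d → R d → ℕ → M₂ d → Set
S₁ d t N A = ∃ λ λ′ → InRange N λ′ ×
  A ≡ ι d λ′ • mat (1R d) t (t *R t) (t *R t *R t)

S₂ : ∀ d → ℕ → M₂ d → Set
S₂ d N A = ∃ λ λ′ → InRange N λ′ × A ≡ mat (0R d) (0R d) (0R d) (ι d λ′)

V₁ : ∀ d → ℕ → M₂ d → Set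
V₁ d N A = IsVertex A × (S₁ d (0R d) N A ⊎ S₂ d N A)

V₂ : ∀ d → ℕ → M₂ d → Set
V₂ d N A = IsVertex A × ∃ λ j → U d j × S₁ d j N A

InducedP₄ : ∀ {d} → (M₂ d → Set) → (M₂ d → M₂ d → Set) → Set
InducedP₄ V Adj = ∃ λ a → ∃ λ b → ∃ λ c → ∃ λ e →
  (V a × V b × V c × V e) ×
  (a ≢ b × a ≢ c × a ≢ e × b ≢ c × b ≢ e × c ≢ e) ×
  (Adj a b × Adj b c × Adj c e) ×
  (¬ Adj a c × ¬ Adj a e × ¬ Adj b e)

IsCograph : ∀ {d} → (M₂ d → Set) → (M₂ d → M₂ d → Set) → Set
IsCograph V Adj = ¬ InducedP₄ V Adj

-- Every vertex is n·M with n a nonzero integer and M one of finitely many shapes: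
-- E₁₁ or E₂₂ for Γ₁, and tc u = [[1,u],[u²,u³]] with u ∈ U for Γ₂.  Whether a product
-- of two vertices vanishes depends only on their shapes: E₁₁E₂₂ = E₂₂E₁₁ = 0 while
-- E₁₁², E₂₂² ≠ 0, and tc x · tc y = (1 + x y²)·N for a nonzero N, because
-- tc u = (1, u²)ᵀ (1, u) has rank one; the integer scalars cancel since R is
-- torsion-free.  An induced P₄ thus yields a P₄ pattern of shapes.  On Γ₁ adjacency is
-- "different shape", which has none; on Γ₂ it is "1 + x y² = 0 or 1 + y x² = 0" among
-- at most six units, which is checked by evaluation.
module Submission where

open import Algebra.Bundles using (CommutativeSemiring)
open import Algebra.Structures using (IsCommutativeSemiring)
open import Algebra.Structures.Biased using (isCommutativeSemiringʳ; isCommutativeMonoidʳ)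
open import Data.Bool using (Bool; true; false; not)
open import Data.Bool.Properties using (¬-not; not-involutive)
open import Data.Empty using (⊥-elim)
open import Data.Fin using (Fin; zero; suc)
open import Data.Fin.Properties using (all?)
open import Data.Integer as ℤ using (ℤ; +_)
import Data.Integer.Properties as ℤ
open import Data.Integer.Tactic.RingSolver using (solve-∀)
open import Data.Nat as ℕ using (ℕ; zero; suc; _≤_)
open import Data.Nat.Properties using (n≮0)
open import Data.Product using (_×_; _,_; proj₁; proj₂; ∃; ∃₂)
open import Data.Product.Properties using (≡-dec)
open import Data.Sum using (_⊎_; inj₁; inj₂; [_,_]′)
open import Data.Vec using (Vec; []; _∷_; lookup)
open import Function using (id; _∘_; _⇔_; mk⇔; Equivalence)
open import Level using (0ℓ)
open import Relation.Binary using (DecidableEquality)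
open import Relation.Binary.PropositionalEquality
open import Relation.Nullary using (¬_; Dec; ¬?; _×-dec_; _⊎-dec_; toWitness)

open import Defs

isCommutativeSemiring : ∀ d → IsCommutativeSemiring _≡_ (_+R_ {d}) (_*R_ {d}) (0R d) (1R d)
isCommutativeSemiring zero    = ℤ.+-*-isCommutativeSemiring
isCommutativeSemiring (suc k) = isCommutativeSemiringʳ record
  { +-isCommutativeMonoid = isCommutativeMonoidʳ record
    { isSemigroup = record
      { isMagma = record { isEquivalence = isEquivalence ; ∙-cong = cong₂ _ }
      ; assoc   = λ { (a , b) (c , e) (f , g) → cong₂ _,_ (ℤ.+-assoc a c f) (ℤ.+-assoc b e g) } }
    ; identityʳ = λ { (a , b) → cong₂ _,_ (ℤ.+-identityʳ a) (ℤ.+-identityʳ b) }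
    ; comm      = λ { (a , b) (c , e) → cong₂ _,_ (ℤ.+-comm a c) (ℤ.+-comm b e) } }
  ; *-isCommutativeMonoid = isCommutativeMonoidʳ record
    { isSemigroup = record
      { isMagma = record { isEquivalence = isEquivalence ; ∙-cong = cong₂ _ }
      ; assoc   = λ { (a , b) (c , e) (f , g) → cong₂ _,_ (*-assoc₁ a b c e f g r s) (*-assoc₂ a b c e f g r s) } }
    ; identityʳ = λ { (a , b) → cong₂ _,_ (*-identityʳ₁ a b r) (*-identityʳ₂ a b s) }
    ; comm      = λ { (a , b) (c , e) → cong₂ _,_ (*-comm₁ a b c e r) (*-comm₂ a b c e s) } }
  ; distribˡ = λ { (a , b) (c , e) (f , g) → cong₂ _,_ (*-distribˡ-+₁ a b c e f g r) (*-distribˡ-+₂ a b c e f g s) }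
  ; zeroʳ    = λ { (a , b) → cong₂ _,_ (*-zeroʳ₁ a b r) (*-zeroʳ₂ a b s) }
  }
  where
  r = θr (suc k)
  s = θs (suc k)
  -- The componentwise identities hold in ℤ[θ] with θ² = s θ + r for any r and s.
  *-assoc₁ : ∀ a b c e f g r s →
    (a ℤ.* c ℤ.+ b ℤ.* e ℤ.* r) ℤ.* f ℤ.+ (a ℤ.* e ℤ.+ b ℤ.* c ℤ.+ b ℤ.* e ℤ.* s) ℤ.* g ℤ.* r
    ≡ a ℤ.* (c ℤ.* f ℤ.+ e ℤ.* g ℤ.* r) ℤ.+ b ℤ.* (c ℤ.* g ℤ.+ e ℤ.* f ℤ.+ e ℤ.* g ℤ.* s) ℤ.* r
  *-assoc₁ = solve-∀
  *-assoc₂ : ∀ a b c e f g r s →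
    (a ℤ.* c ℤ.+ b ℤ.* e ℤ.* r) ℤ.* g ℤ.+ (a ℤ.* e ℤ.+ b ℤ.* c ℤ.+ b ℤ.* e ℤ.* s) ℤ.* f
      ℤ.+ (a ℤ.* e ℤ.+ b ℤ.* c ℤ.+ b ℤ.* e ℤ.* s) ℤ.* g ℤ.* s
    ≡ a ℤ.* (c ℤ.* g ℤ.+ e ℤ.* f ℤ.+ e ℤ.* g ℤ.* s) ℤ.+ b ℤ.* (c ℤ.* f ℤ.+ e ℤ.* g ℤ.* r)
      ℤ.+ b ℤ.* (c ℤ.* g ℤ.+ e ℤ.* f ℤ.+ e ℤ.* g ℤ.* s) ℤ.* s
  *-assoc₂ = solve-∀
  *-identityʳ₁ : ∀ a b r → a ℤ.* + 1 ℤ.+ b ℤ.* + 0 ℤ.* r ≡ a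
  *-identityʳ₁ = solve-∀
  *-identityʳ₂ : ∀ a b s → a ℤ.* + 0 ℤ.+ b ℤ.* + 1 ℤ.+ b ℤ.* + 0 ℤ.* s ≡ b
  *-identityʳ₂ = solve-∀
  *-comm₁ : ∀ a b c e r → a ℤ.* c ℤ.+ b ℤ.* e ℤ.* r ≡ c ℤ.* a ℤ.+ e ℤ.* b ℤ.* r
  *-comm₁ = solve-∀
  *-comm₂ : ∀ a b c e s → a ℤ.* e ℤ.+ b ℤ.* c ℤ.+ b ℤ.* e ℤ.* s ≡ c ℤ.* b ℤ.+ e ℤ.* a ℤ.+ e ℤ.* b ℤ.* s
  *-comm₂ = solve-∀
  *-distribˡ-+₁ : ∀ a b c e f g r → a ℤ.* (c ℤ.+ f) ℤ.+ b ℤ.* (e ℤ.+ g) ℤ.* r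
    ≡ (a ℤ.* c ℤ.+ b ℤ.* e ℤ.* r) ℤ.+ (a ℤ.* f ℤ.+ b ℤ.* g ℤ.* r)
  *-distribˡ-+₁ = solve-∀
  *-distribˡ-+₂ : ∀ a b c e f g s → a ℤ.* (e ℤ.+ g) ℤ.+ b ℤ.* (c ℤ.+ f) ℤ.+ b ℤ.* (e ℤ.+ g) ℤ.* s
    ≡ (a ℤ.* e ℤ.+ b ℤ.* c ℤ.+ b ℤ.* e ℤ.* s) ℤ.+ (a ℤ.* g ℤ.+ b ℤ.* f ℤ.+ b ℤ.* g ℤ.* s)
  *-distribˡ-+₂ = solve-∀
  *-zeroʳ₁ : ∀ a b r → a ℤ.* + 0 ℤ.+ b ℤ.* + 0 ℤ.* r ≡ + 0
  *-zeroʳ₁ = solve-∀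
  *-zeroʳ₂ : ∀ a b s → a ℤ.* + 0 ℤ.+ b ℤ.* + 0 ℤ.+ b ℤ.* + 0 ℤ.* s ≡ + 0
  *-zeroʳ₂ = solve-∀

commutativeSemiring : ℕ → CommutativeSemiring 0ℓ 0ℓ
commutativeSemiring d = record
  { Carrier = R d ; _≈_ = _≡_ ; _+_ = _+R_ ; _*_ = _*R_ ; 0# = 0R d ; 1# = 1R d
  ; isCommutativeSemiring = isCommutativeSemiring d }

ι≡0⇒≡0 : ∀ d {l} → ι d l ≡ 0R d → l ≡ + 0
ι≡0⇒≡0 zero    = id
ι≡0⇒≡0 (suc _) = cong proj₁

ℤ-*-cancelˡ : ∀ {l c} → l ≢ + 0 → l ℤ.* c ≡ + 0 → c ≡ + 0
ℤ-*-cancelˡ {l} l≢0 lc≡0 = [ ⊥-elim ∘ l≢0 , id ]′ (ℤ.i*j≡0⇒i≡0∨j≡0 l lc≡0)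

ι-*-cancelˡ : ∀ d {l} c → l ≢ + 0 → ι d l *R c ≡ 0R d → c ≡ 0R d
ι-*-cancelˡ zero    c       l≢0 lc≡0 = ℤ-*-cancelˡ l≢0 lc≡0
-- ι l · (a + bθ) is (l a + 0) + (l b + 0 + 0)θ definitionally.
ι-*-cancelˡ (suc _) (a , b) l≢0 lc≡0 = cong₂ _,_
  (ℤ-*-cancelˡ l≢0 (trans (sym (ℤ.+-identityʳ _)) (cong proj₁ lc≡0)))
  (ℤ-*-cancelˡ l≢0 (trans (sym (trans (ℤ.+-identityʳ _) (ℤ.+-identityʳ _))) (cong proj₂ lc≡0)))

module _ {d : ℕ} where
  open CommutativeSemiring (commutativeSemiring d) using (_+_; _*_; 0#; 1#; zeroˡ; zeroʳ; *-identityʳ; *-assoc)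
  open import Algebra.Solver.Ring.NaturalCoefficients.Default (commutativeSemiring d)

  cong-mat : ∀ {a b c e a′ b′ c′ e′ : R d} →
    a ≡ a′ → b ≡ b′ → c ≡ c′ → e ≡ e′ → mat a b c e ≡ mat a′ b′ c′ e′
  cong-mat refl refl refl refl = refl

  diag : R d → R d → M₂ d
  diag a e = mat a 0# 0# e

  tc : R d → M₂ d
  tc t = mat 1# t (t * t) (t * t * t)

  •-zeroˡ : ∀ A → 0# • A ≡ 0M d
  •-zeroˡ (mat a b c e) = cong-mat (zeroˡ a) (zeroˡ b) (zeroˡ c) (zeroˡ e)

  diag-·M-diag : ∀ a e a′ e′ → diag a e ·M diag a′ e′ ≡ diag (a * a′) (e * e′)
  diag-·M-diag a e a′ e′ = cong-mat
    (solve 2 (λ a a′ → a :* a′ :+ con 0 :* con 0 := a :* a′) refl a a′)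
    (solve 2 (λ a e′ → a :* con 0 :+ con 0 :* e′ := con 0) refl a e′)
    (solve 2 (λ e a′ → con 0 :* a′ :+ e :* con 0 := con 0) refl e a′)
    (solve 2 (λ e e′ → con 0 :* con 0 :+ e :* e′ := e :* e′) refl e e′)

  •-tc-0 : ∀ a → a • tc 0# ≡ diag a 0#
  •-tc-0 a = cong-mat
    (solve 1 (λ a → a :* con 1 := a) refl a)
    (solve 1 (λ a → a :* con 0 := con 0) refl a)
    (solve 1 (λ a → a :* (con 0 :* con 0) := con 0) refl a)
    (solve 1 (λ a → a :* (con 0 :* con 0 :* con 0) := con 0) refl a)

  Annihilates : R d → R d → Set
  Annihilates x y = 1# + x * (y * y) ≡ 0#

  -- tc x = (1, x²)ᵀ (1, x) has rank one, so in a product of two of them only the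
  -- inner product (1, x) (1, y²)ᵀ = 1 + x y² survives as a scalar.
  •-tc-·M-•-tc : ∀ L M x y →
    (L • tc x) ·M (M • tc y) ≡ (L * M * (1# + x * (y * y))) • mat 1# y (x * x) (x * x * y)
  •-tc-·M-•-tc L M x y = cong-mat
    (solve 4 (λ L M x y → (L :* con 1) :* (M :* con 1) :+ (L :* x) :* (M :* (y :* y))
                        := (L :* M :* (con 1 :+ x :* (y :* y))) :* con 1) refl L M x y)
    (solve 4 (λ L M x y → (L :* con 1) :* (M :* y) :+ (L :* x) :* (M :* (y :* y :* y))
                        := (L :* M :* (con 1 :+ x :* (y :* y))) :* y) refl L M x y)
    (solve 4 (λ L M x y → (L :* (x :* x)) :* (M :* con 1) :+ (L :* (x :* x :* x)) :* (M :* (y :* y))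
                        := (L :* M :* (con 1 :+ x :* (y :* y))) :* (x :* x)) refl L M x y)
    (solve 4 (λ L M x y → (L :* (x :* x)) :* (M :* y) :+ (L :* (x :* x :* x)) :* (M :* (y :* y :* y))
                        := (L :* M :* (con 1 :+ x :* (y :* y))) :* (x :* x :* y)) refl L M x y)

  ι•tc-·M-ι•tc≡0⇔ : ∀ {l m} x y → l ≢ + 0 → m ≢ + 0 →
    (ι d l • tc x) ·M (ι d m • tc y) ≡ 0M d ⇔ Annihilates x y
  ι•tc-·M-ι•tc≡0⇔ {l} {m} x y l≢0 m≢0 = mk⇔ to from
    where
    open ≡-Reasoning
    L = ι d l
    M = ι d m
    k = 1# + x * (y * y)
    N = mat 1# y (x * x) (x * x * y)
    to : (L • tc x) ·M (M • tc y) ≡ 0M d → Annihilates x y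
    to LM≡0 = ι-*-cancelˡ d k m≢0 (ι-*-cancelˡ d (M * k) l≢0 (begin
      L * (M * k)      ≡⟨ sym (*-assoc L M k) ⟩
      L * M * k        ≡⟨ sym (*-identityʳ (L * M * k)) ⟩
      L * M * k * 1#   ≡⟨ cong m11 (trans (sym (•-tc-·M-•-tc L M x y)) LM≡0) ⟩
      0#               ∎))
    from : Annihilates x y → (L • tc x) ·M (M • tc y) ≡ 0M d
    from k≡0 = begin
      (L • tc x) ·M (M • tc y) ≡⟨ •-tc-·M-•-tc L M x y ⟩
      (L * M * k) • N          ≡⟨ cong (λ k → (L * M * k) • N) k≡0 ⟩
      (L * M * 0#) • N         ≡⟨ cong (_• N) (zeroʳ (L * M)) ⟩
      0# • N                   ≡⟨ •-zeroˡ N ⟩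
      0M d                     ∎

  ι*ι≢0 : ∀ {l m} → l ≢ + 0 → m ≢ + 0 → ι d l * ι d m ≢ 0#
  ι*ι≢0 l≢0 m≢0 = m≢0 ∘ ι≡0⇒≡0 d ∘ ι-*-cancelˡ d _ l≢0

  slot : Bool → R d → M₂ d
  slot false a = diag a 0#
  slot true  a = diag 0# a

  slot-·M-slot≡0⇔ : ∀ {l m} s t → l ≢ + 0 → m ≢ + 0 →
    slot s (ι d l) ·M slot t (ι d m) ≡ 0M d ⇔ s ≢ t
  slot-·M-slot≡0⇔ {l} {m} s t l≢0 m≢0 = mk⇔ (to s t) (from s t)
    where
    L = ι d l
    M = ι d m
    to : ∀ s t → slot s L ·M slot t M ≡ 0M d → s ≢ t
    to false false LM≡0 _ = ι*ι≢0 l≢0 m≢0 (cong m11 (trans (sym (diag-·M-diag L 0# M 0#)) LM≡0))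
    to true  true  LM≡0 _ = ι*ι≢0 l≢0 m≢0 (cong m22 (trans (sym (diag-·M-diag 0# L 0# M)) LM≡0))
    to false true  _ ()
    to true  false _ ()
    from : ∀ s t → s ≢ t → slot s L ·M slot t M ≡ 0M d
    from false false s≢t = ⊥-elim (s≢t refl)
    from true  true  s≢t = ⊥-elim (s≢t refl)
    from false true  _   = trans (diag-·M-diag L 0# 0# M) (cong₂ diag (zeroʳ L) (zeroˡ M))
    from true  false _   = trans (diag-·M-diag 0# L M 0#) (cong₂ diag (zeroˡ M) (zeroʳ L))

P4Pattern : {L : Set} → (L → L → Set) → L → L → L → L → Set
P4Pattern _~_ x y z w = (x ~ y × y ~ z × z ~ w) × (¬ x ~ z × ¬ x ~ w × ¬ y ~ w)

P4Free : {L : Set} → (L → L → Set) → Set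
P4Free _~_ = ∀ x y z w → ¬ P4Pattern _~_ x y z w

SymClosure : {L : Set} → (L → L → Set) → L → L → Set
SymClosure _∼_ x y = x ∼ y ⊎ y ∼ x

module _ {d : ℕ} {L : Set} (matrix : L → ℤ → M₂ d) {_∼_ : L → L → Set}
         (·M≡0⇔ : ∀ {l m} x y → l ≢ + 0 → m ≢ + 0 → matrix x l ·M matrix y m ≡ 0M d ⇔ x ∼ y)
         where

  -- Vertices with equal labels are twins, so the labels of an induced P₄ need not be
  -- distinct: they only form a P4Pattern.
  cograph-by-labels : {V : M₂ d → Set} →
    (∀ {a} → V a → ∃₂ λ x l → l ≢ + 0 × matrix x l ≡ a) →
    P4Free (SymClosure _∼_) → IsCograph V UAdj
  cograph-by-labels represent free
    (a , b , c , e , (va , vb , vc , ve) , (_ , a≢c , a≢e , _ , b≢e , _) , (ab , bc , ce) , (¬ac , ¬ae , ¬be))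
    with represent va | represent vb | represent vc | represent ve
  ... | x , _ , l≢0 , refl | y , _ , m≢0 , refl | z , _ , n≢0 , refl | w , _ , o≢0 , refl =
    free x y z w
      ( (adj⇒∼ l≢0 m≢0 ab , adj⇒∼ m≢0 n≢0 bc , adj⇒∼ n≢0 o≢0 ce)
      , (¬ac ∘ ∼⇒adj l≢0 n≢0 a≢c , ¬ae ∘ ∼⇒adj l≢0 o≢0 a≢e , ¬be ∘ ∼⇒adj m≢0 o≢0 b≢e))
    where
    adj⇒∼ : ∀ {x y l m} → l ≢ + 0 → m ≢ + 0 → UAdj (matrix x l) (matrix y m) → SymClosure _∼_ x y
    adj⇒∼ {x} {y} l≢0 m≢0 (inj₁ (_ , xy≡0)) = inj₁ (Equivalence.to (·M≡0⇔ x y l≢0 m≢0) xy≡0)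
    adj⇒∼ {x} {y} l≢0 m≢0 (inj₂ (_ , yx≡0)) = inj₂ (Equivalence.to (·M≡0⇔ y x m≢0 l≢0) yx≡0)
    ∼⇒adj : ∀ {x y l m} → l ≢ + 0 → m ≢ + 0 → matrix x l ≢ matrix y m →
      SymClosure _∼_ x y → UAdj (matrix x l) (matrix y m)
    ∼⇒adj {x} {y} l≢0 m≢0 ne (inj₁ x∼y) = inj₁ (ne , Equivalence.from (·M≡0⇔ x y l≢0 m≢0) x∼y)
    ∼⇒adj {x} {y} l≢0 m≢0 ne (inj₂ y∼x) = inj₂ (≢-sym ne , Equivalence.from (·M≡0⇔ y x m≢0 l≢0) y∼x)

InRange⇒≢0 : ∀ {N l} → InRange N l → l ≢ + 0
InRange⇒≢0 (1≤∣l∣ , _) refl = n≮0 1≤∣l∣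

Bool-≢-P4Free : P4Free (SymClosure (_≢_ {A = Bool}))
Bool-≢-P4Free x y z w ((xy , yz , zw) , _ , ¬xw , _) = ¬xw (inj₁ (≢ʳ zw ∘ trans (sym x≡z)))
  where
  ≢ʳ : ∀ {s t : Bool} → SymClosure _≢_ s t → s ≢ t
  ≢ʳ = [ id , ≢-sym ]′
  x≡z : x ≡ z
  x≡z = trans (¬-not (≢ʳ xy)) (trans (cong not (¬-not (≢ʳ yz))) (not-involutive z))

V₁-labelled : ∀ {d N a} → V₁ d N a → ∃₂ λ s l → l ≢ + 0 × slot s (ι d l) ≡ a
V₁-labelled (_ , inj₁ (l , l∈ , refl)) = false , l , InRange⇒≢0 l∈ , sym (•-tc-0 _)
V₁-labelled (_ , inj₂ (l , l∈ , refl)) = true  , l , InRange⇒≢0 l∈ , refl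

Γ₁-cograph : ∀ d N → IsCograph (V₁ d N) UAdj
Γ₁-cograph d N = cograph-by-labels (λ s l → slot s (ι d l)) slot-·M-slot≡0⇔ V₁-labelled Bool-≢-P4Free

extraUnitCount : ℕ → ℕ
extraUnitCount 1 = 2
extraUnitCount 3 = 4
extraUnitCount _ = 0

unitCount : ℕ → ℕ
unitCount d = 2 ℕ.+ extraUnitCount d

extraUnits : ∀ d → Vec (R d) (extraUnitCount d)
extraUnits 0 = []
extraUnits 1 = θ 0 ∷ -R_ {1} (θ 0) ∷ []
extraUnits 2 = []
extraUnits 3 = ω₃ 2 ∷ -R_ {3} (ω₃ 2) ∷ ω² ∷ -R_ {3} ω² ∷ []
  where ω² = _*R_ {3} (ω₃ 2) (ω₃ 2)
extraUnits (suc (suc (suc (suc _)))) = []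

unit : ∀ d → Fin (unitCount d) → R d
unit d = lookup (1R d ∷ -R_ {d} (1R d) ∷ extraUnits d)

unit-index : ∀ d {j} → U d j → ∃ λ i → unit d i ≡ j
unit-index zero (inj₁ refl) = zero , refl
unit-index zero (inj₂ refl) = suc zero , refl
unit-index (suc _) (inj₁ refl)        = zero , refl
unit-index (suc _) (inj₂ (inj₁ refl)) = suc zero , refl
unit-index (suc _) (inj₂ (inj₂ (inj₁ (refl , inj₁ refl)))) = suc (suc zero) , refl
unit-index (suc _) (inj₂ (inj₂ (inj₁ (refl , inj₂ refl)))) = suc (suc (suc zero)) , refl
unit-index (suc _) (inj₂ (inj₂ (inj₂ (refl , inj₁ refl)))) = suc (suc zero) , refl
unit-index (suc _) (inj₂ (inj₂ (inj₂ (refl , inj₂ (inj₁ refl))))) = suc (suc (suc zero)) , refl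
unit-index (suc _) (inj₂ (inj₂ (inj₂ (refl , inj₂ (inj₂ (inj₁ refl)))))) = suc (suc (suc (suc zero))) , refl
unit-index (suc _) (inj₂ (inj₂ (inj₂ (refl , inj₂ (inj₂ (inj₂ refl)))))) = suc (suc (suc (suc (suc zero)))) , refl

UnitsAnnihilate : ∀ d → Fin (unitCount d) → Fin (unitCount d) → Set
UnitsAnnihilate d i j = Annihilates (unit d i) (unit d j)

_≟R_ : ∀ {d} → DecidableEquality (R d)
_≟R_ {zero}  = ℤ._≟_
_≟R_ {suc _} = ≡-dec ℤ._≟_ ℤ._≟_

P4Pattern? : {L : Set} {_~_ : L → L → Set} → (∀ x y → Dec (x ~ y)) →
  ∀ x y z w → Dec (P4Pattern _~_ x y z w)
P4Pattern? _~?_ x y z w =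
  (x ~? y ×-dec y ~? z ×-dec z ~? w) ×-dec (¬? (x ~? z) ×-dec ¬? (x ~? w) ×-dec ¬? (y ~? w))

P4Free? : ∀ {n} {_~_ : Fin n → Fin n → Set} → (∀ x y → Dec (x ~ y)) → Dec (P4Free _~_)
P4Free? _~?_ = all? λ x → all? λ y → all? λ z → all? λ w → ¬? (P4Pattern? _~?_ x y z w)

units-P4Free? : ∀ d → Dec (P4Free (SymClosure (UnitsAnnihilate d)))
units-P4Free? d = P4Free? λ i j → annihilate? i j ⊎-dec annihilate? j i
  where
  annihilate? : ∀ i j → Dec (UnitsAnnihilate d i j)
  annihilate? i j = _ ≟R 0R d

-- Decided by evaluation; for d ≥ 4 neither U nor the arithmetic of ±1 depends on d.
units-P4Free : ∀ d → P4Free (SymClosure (UnitsAnnihilate d))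
units-P4Free 0 = toWitness {a? = units-P4Free? 0} _
units-P4Free 1 = toWitness {a? = units-P4Free? 1} _
units-P4Free 2 = toWitness {a? = units-P4Free? 2} _
units-P4Free 3 = toWitness {a? = units-P4Free? 3} _
units-P4Free d@(suc (suc (suc (suc _)))) = toWitness {a? = units-P4Free? d} _

V₂-labelled : ∀ {d N a} → V₂ d N a → ∃₂ λ i l → l ≢ + 0 × ι d l • tc (unit d i) ≡ a
V₂-labelled {d} (_ , _ , j∈U , l , l∈ , refl) with unit-index d j∈U
... | i , refl = i , l , InRange⇒≢0 l∈ , refl

Γ₂-cograph : ∀ d N → IsCograph (V₂ d N) UAdj
Γ₂-cograph d N = cograph-by-labels (λ i l → ι d l • tc (unit d i))
  (λ i j → ι•tc-·M-ι•tc≡0⇔ (unit d i) (unit d j)) V₂-labelled (units-P4Free d)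

theorem3p14 : (d : ℕ) → Admissible d → (n : ℕ) → 1 ≤ n →
    IsCograph (V₁ d n) UAdj × IsCograph (V₂ d n) UAdj
theorem3p14 d _ n _ = Γ₁-cograph d n , Γ₂-cograph d n
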